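{- Let $C$ and $D$ be clique trees, and let $\varphi: T_C\to S$ be an isomorphism from $T_C$ onto a subgraph $S$ of $T_D$ such that $\varphi(V(T_C)\cap V(C))\subseteq V(S)\cap V(D)$. Then $\varphi(V(C))\subseteq V(D)$ and the map $\psi: V(C)\to \varphi(V(C))$ given by $\psi(v)=\varphi(v)$ is an isomorphism from $C$ to the induced subgraph $D[\varphi(V(C))]$.
   Context: All graphs are finite and simple. A block of a graph is a maximal subgraph without cut-vertices. A clique tree is a connected graph each of whose blocks is a complete graph. For a clique tree $W$, the canonical tree $T_W$ is the graph with vertex set $V(W)\cup\{v_B : B \text{ a block of } W\}$, where the $v_B$ are new vertices (one per block), and edge set $\{u v_B : B \text{ a block of } W,\ u\in V(B)\}$. $D[X]$ denotes the subgraph of $D$ induced by $X$. -}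

module Defs where

open import Data.Nat using (ℕ)
open import Data.Fin using (Fin)
open import Data.Bool using (Bool; true; false)
open import Data.Sum using (_⊎_; inj₁; inj₂; [_,_]′)
open import Data.Product using (Σ; _×_; _,_; ∃; ∃-syntax)
open import Data.Unit using (⊤)
open import Relation.Nullary using (¬_)
open import Relation.Binary.PropositionalEquality using (_≡_; _≢_)
open import Function.Bundles using (_⇔_)

record Graph : Set where
  field
    n      : ℕ
    adj    : Fin n → Fin n → Bool
    sym    : ∀ u v → adj u v ≡ adj v u
    irrefl : ∀ u → adj u u ≡ false

open Graph public

Edge : (G : Graph) → Fin (n G) → Fin (n G) → Set
Edge G u v = adj G u v ≡ true

record Subgraph (G : Graph) : Set where
  field
    inV    : Fin (n G) → Bool
    inE    : Fin (n G) → Fin (n G) → Bool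
    inE-sym : ∀ u v → inE u v ≡ inE v u
    inE-adj : ∀ u v → inE u v ≡ true → adj G u v ≡ true
    inE-V   : ∀ u v → inE u v ≡ true → inV u ≡ true

open Subgraph public

full : (G : Graph) → Subgraph G
full G = record
  { inV = λ _ → true
  ; inE = adj G
  ; inE-sym = sym G
  ; inE-adj = λ _ _ e → e
  ; inE-V = λ _ _ _ → _≡_.refl
  }

_⊆ₛ_ : {G : Graph} → Subgraph G → Subgraph G → Set
H ⊆ₛ H' = (∀ u → inV H u ≡ true → inV H' u ≡ true)
        × (∀ u v → inE H u v ≡ true → inE H' u v ≡ true)

_≐_ : {G : Graph} → Subgraph G → Subgraph G → Set
H ≐ H' = (H ⊆ₛ H') × (H' ⊆ₛ H)

data Walk {G : Graph} (H : Subgraph G) (ok : Fin (n G) → Set)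
     : Fin (n G) → Fin (n G) → Set where
  here : ∀ {a} → inV H a ≡ true → ok a → Walk H ok a a
  step : ∀ {a c b} → ok a → inE H a c ≡ true → Walk H ok c b → Walk H ok a b

Reach : {G : Graph} → Subgraph G → Fin (n G) → Fin (n G) → Set
Reach H = Walk H (λ _ → ⊤)

-- a and b lie in the same component of H - v.
ReachAvoiding : {G : Graph} → Subgraph G → Fin (n G) → Fin (n G) → Fin (n G) → Set
ReachAvoiding H v = Walk H (λ x → x ≢ v)

Connected : {G : Graph} → Subgraph G → Set
Connected H = (∃[ u ] inV H u ≡ true)
            × (∀ a b → inV H a ≡ true → inV H b ≡ true → Reach H a b)

-- v is a cut-vertex of H: deleting v increases the number of components,
-- i.e. two vertices other than v in the same component of H are in
-- different components of H - v.
CutVertex : {G : Graph} → Subgraph G → Fin (n G) → Set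
CutVertex H v = (inV H v ≡ true) × ∃[ a ] ∃[ b ]
  ((a ≢ v) × (b ≢ v) × Reach H a b × ¬ ReachAvoiding H v a b)

NoCutVertex : {G : Graph} → Subgraph G → Set
NoCutVertex H = ∀ v → ¬ CutVertex H v

IsBlock : (G : Graph) → Subgraph G → Set
IsBlock G B = Connected B × NoCutVertex B
  × (∀ (H : Subgraph G) → B ⊆ₛ H → Connected H → NoCutVertex H → H ≐ B)

Complete : {G : Graph} → Subgraph G → Set
Complete H = ∀ u v → inV H u ≡ true → inV H v ≡ true → u ≢ v → inE H u v ≡ true

IsCliqueTree : Graph → Set
IsCliqueTree W = Connected (full W) × (∀ B → IsBlock W B → Complete B)

-- T is (a copy of) the canonical tree T_W of W:
-- V(T) is the disjoint union of V(W) (via vert) and one new vertex per block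
-- (via bv, with blocks listed without repetition by blk), and the edges
-- of T are exactly u v_B with u ∈ V(B).
record CanonicalTree (W : Graph) (T : Graph) : Set where
  field
    k      : ℕ
    blk    : Fin k → Subgraph W
    vert   : Fin (n W) → Fin (n T)
    bv     : Fin k → Fin (n T)
    emb-inj  : ∀ x y → [ vert , bv ]′ x ≡ [ vert , bv ]′ y → x ≡ y
    emb-surj : ∀ t → ∃[ x ] [ vert , bv ]′ x ≡ t
    blk-isBlock : ∀ i → IsBlock W (blk i)
    blk-inj     : ∀ i j → blk i ≐ blk j → i ≡ j
    blk-surj    : ∀ B → IsBlock W B → ∃[ i ] blk i ≐ B
    adj-vv : ∀ u u' → adj T (vert u) (vert u') ≡ false
    adj-bb : ∀ i j → adj T (bv i) (bv j) ≡ false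
    adj-vb : ∀ u i → adj T (vert u) (bv i) ≡ inV (blk i) u

-- Write ψ for the restriction of φ to V(C). For a block B of C, the vertex φ(v_B) is adjacent to vertices
-- of D, so it is a block vertex v_B′ of T_D, and ψ maps B into the complete block B′; hence ψ preserves edges.
-- Conversely, let ψu ψv be an edge of D, lying in a block B′. The ψ-image of a u–v path of C together with
-- B′ is connected without cut-vertices, so by maximality of B′ the whole image lies in B′. Each edge of the
-- path lies in a block of C, whose image block shares two vertices with B′ and therefore is B′; injectivity
-- of φ then makes all these blocks of C one and the same complete block, which contains u and v.

module Submission where

open import Defs hiding (sym)
open import Level using (0ℓ)
open import Data.Nat using (ℕ; zero; suc; _+_; _*_; _∸_; _≤_; _<_; z≤n)
open import Data.Nat.Properties
  using (≤-refl; ≤-antisym; +-mono-≤; +-mono-<-≤; +-mono-≤-<; <⇒≢; ≮⇒≥; ≤∧≢⇒<; ∸-monoʳ-<)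
open import Data.Nat.Induction using (<-wellFounded)
open import Data.Fin using (Fin; _≟_) renaming (zero to fzero; suc to fsuc)
open import Data.Bool using (Bool; true; false; _∨_)
import Data.Bool as Bool
open import Data.Sum using (_⊎_; inj₁; inj₂; [_,_]′)
import Data.Sum as Sum
open import Data.Sum.Properties using (inj₁-injective; inj₂-injective)
import Data.Product as Product
open import Data.Product using (Σ; _×_; _,_; ∃; ∃-syntax; proj₁; proj₂)
open import Data.Unit using (⊤; tt)
open import Data.Empty using (⊥-elim)
open import Effect.Monad using (RawMonad)
open import Function.Base using (_∘_; _on_)
open import Function.Bundles using (_⇔_; mk⇔)
open import Induction.WellFounded using (WellFounded; Acc; acc; module Subrelation)
open import Relation.Binary.Construct.On as On using ()
open import Relation.Nullary using (¬_; Dec; yes; no; does; contradiction)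
open import Relation.Nullary.Decidable
  using (decidable-stable; dec-true; dec-false; does-⇔; _×-dec_; _⊎-dec_; ¬¬-excluded-middle)
open import Relation.Nullary.Negation using (¬¬-Monad; DoubleNegation)
open import Relation.Binary.PropositionalEquality
  using (_≡_; refl; _≢_; sym; trans; cong; cong₂; subst)

open RawMonad (¬¬-Monad {0ℓ}) using (pure; _>>=_)

≡-stable : {b c : Bool} → DoubleNegation (b ≡ c) → b ≡ c
≡-stable {b} {c} = decidable-stable (b Bool.≟ c)

∨-true⁻ : ∀ {a b} → a ∨ b ≡ true → a ≡ true ⊎ b ≡ true
∨-true⁻ {true} _ = inj₁ refl
∨-true⁻ {false} e = inj₂ e

∨-false⁻ : ∀ {a b} → a ∨ b ≡ false → a ≡ false × b ≡ false
∨-false⁻ {false} e = refl , e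

∨-trueˡ : ∀ {a} b → a ≡ true → a ∨ b ≡ true
∨-trueˡ b refl = refl

∨-trueʳ : ∀ a {b} → b ≡ true → a ∨ b ≡ true
∨-trueʳ true _ = refl
∨-trueʳ false e = e

true≢false : ∀ {b} → b ≡ true → b ≢ false
true≢false refl ()

does⇒ : ∀ {P : Set} (P? : Dec P) → does P? ≡ true → P
does⇒ (yes p) _ = p

indicator : Bool → ℕ
indicator true = 1
indicator false = 0

indicator-mono : ∀ {a b} → (a ≡ true → b ≡ true) → indicator a ≤ indicator b
indicator-mono {false} _ = z≤n
indicator-mono {true} h rewrite h refl = ≤-refl

indicator-≤1 : ∀ a → indicator a ≤ 1
indicator-≤1 true = ≤-refl
indicator-≤1 false = z≤n

indicator-injective : ∀ {a b} → indicator a ≡ indicator b → a ≡ b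
indicator-injective {true} {true} _ = refl
indicator-injective {false} {false} _ = refl

∑ : ∀ {m} → (Fin m → ℕ) → ℕ
∑ {zero} f = 0
∑ {suc m} f = f fzero + ∑ (f ∘ fsuc)

∑-mono-≤ : ∀ {m} {f g : Fin m → ℕ} → (∀ x → f x ≤ g x) → ∑ f ≤ ∑ g
∑-mono-≤ {zero} _ = z≤n
∑-mono-≤ {suc m} f≤g = +-mono-≤ (f≤g fzero) (∑-mono-≤ (f≤g ∘ fsuc))

∑-≤ : ∀ {m} {f : Fin m → ℕ} c → (∀ x → f x ≤ c) → ∑ f ≤ m * c
∑-≤ {zero} _ _ = z≤n
∑-≤ {suc m} c f≤c = +-mono-≤ (f≤c fzero) (∑-≤ c (f≤c ∘ fsuc))

+-≡-componentwise : ∀ {a a′ b b′} → a ≤ a′ → b ≤ b′ → a + b ≡ a′ + b′ → a ≡ a′ × b ≡ b′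
+-≡-componentwise a≤a′ b≤b′ e =
  ≤-antisym a≤a′ (≮⇒≥ (λ a<a′ → <⇒≢ (+-mono-<-≤ a<a′ b≤b′) e)) ,
  ≤-antisym b≤b′ (≮⇒≥ (λ b<b′ → <⇒≢ (+-mono-≤-< a≤a′ b<b′) e))

∑-≡-pointwise : ∀ {m} {f g : Fin m → ℕ} → (∀ x → f x ≤ g x) → ∑ f ≡ ∑ g → ∀ x → f x ≡ g x
∑-≡-pointwise {suc m} {f} {g} f≤g e = λ
  { fzero → proj₁ head-and-tail
  ; (fsuc x) → ∑-≡-pointwise (f≤g ∘ fsuc) (proj₂ head-and-tail) x }
  where
  head-and-tail : f fzero ≡ g fzero × ∑ (f ∘ fsuc) ≡ ∑ (g ∘ fsuc)
  head-and-tail = +-≡-componentwise (f≤g fzero) (∑-mono-≤ (f≤g ∘ fsuc)) e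

infix 4 _∈ᵥ_ _∉ᵥ_

_∈ᵥ_ : {G : Graph} → Fin (n G) → Subgraph G → Set
x ∈ᵥ H = inV H x ≡ true

_∉ᵥ_ : {G : Graph} → Fin (n G) → Subgraph G → Set
x ∉ᵥ H = inV H x ≡ false

module _ {G : Graph} {H : Subgraph G} {ok : Fin (n G) → Set} where

  source∈ : ∀ {a b} → Walk H ok a b → a ∈ᵥ H
  source∈ (here a∈H _) = a∈H
  source∈ (step _ e _) = inE-V H _ _ e

  target∈ : ∀ {a b} → Walk H ok a b → b ∈ᵥ H
  target∈ (here b∈H _) = b∈H
  target∈ (step _ _ w) = target∈ w

  source-ok : ∀ {a b} → Walk H ok a b → ok a
  source-ok (here _ oa) = oa
  source-ok (step oa _ _) = oa

  target-ok : ∀ {a b} → Walk H ok a b → ok b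
  target-ok (here _ ob) = ob
  target-ok (step _ _ w) = target-ok w

  infixr 5 _++ᵂ_

  _++ᵂ_ : ∀ {a b c} → Walk H ok a b → Walk H ok b c → Walk H ok a c
  here _ _ ++ᵂ w′ = w′
  step oa e w ++ᵂ w′ = step oa e (w ++ᵂ w′)

  edge-walk : ∀ {a b} → ok a → ok b → inE H a b ≡ true → Walk H ok a b
  edge-walk oa ob e = step oa e (here (inE-V H _ _ (trans (inE-sym H _ _) e)) ob)

  reverse : ∀ {a b} → Walk H ok a b → Walk H ok b a
  reverse (here a∈H oa) = here a∈H oa
  reverse (step {a} {c} oa e w) = reverse w ++ᵂ edge-walk (source-ok w) oa (trans (inE-sym H c a) e)

module _ {G : Graph} where

  ⊆ₛ-refl : {A : Subgraph G} → A ⊆ₛ A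
  ⊆ₛ-refl = (λ _ e → e) , (λ _ _ e → e)

  ⊆ₛ-trans : {A B C : Subgraph G} → A ⊆ₛ B → B ⊆ₛ C → A ⊆ₛ C
  ⊆ₛ-trans (A⊆B , EA⊆EB) (B⊆C , EB⊆EC) =
    (λ u → B⊆C u ∘ A⊆B u) , (λ u v → EB⊆EC u v ∘ EA⊆EB u v)

  ⊆ₛ-stable : {A B : Subgraph G} → DoubleNegation (A ⊆ₛ B) → A ⊆ₛ B
  ⊆ₛ-stable ¬¬A⊆B =
    (λ u u∈A → ≡-stable (λ ¬u∈B → ¬¬A⊆B (λ A⊆B → ¬u∈B (proj₁ A⊆B u u∈A)))) ,
    (λ u v uv∈A → ≡-stable (λ ¬uv∈B → ¬¬A⊆B (λ A⊆B → ¬uv∈B (proj₂ A⊆B u v uv∈A))))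

  ⊆-walk : ∀ {A B : Subgraph G} {ok a b} → A ⊆ₛ B → Walk A ok a b → Walk B ok a b
  ⊆-walk A⊆B (here a∈A oa) = here (proj₁ A⊆B _ a∈A) oa
  ⊆-walk A⊆B (step oa e w) = step oa (proj₂ A⊆B _ _ e) (⊆-walk A⊆B w)

  infixl 25 _∪ₛ_

  _∪ₛ_ : Subgraph G → Subgraph G → Subgraph G
  A ∪ₛ B = record
    { inV = λ x → inV A x ∨ inV B x
    ; inE = λ x y → inE A x y ∨ inE B x y
    ; inE-sym = λ x y → cong₂ _∨_ (inE-sym A x y) (inE-sym B x y)
    ; inE-adj = λ x y → [ inE-adj A x y , inE-adj B x y ]′ ∘ ∨-true⁻
    ; inE-V = λ x y → [ ∨-trueˡ (inV B x) ∘ inE-V A x y , ∨-trueʳ (inV A x) ∘ inE-V B x y ]′ ∘ ∨-true⁻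
    }

  ⊆-∪ˡ : (A B : Subgraph G) → A ⊆ₛ A ∪ₛ B
  ⊆-∪ˡ A B = (λ u → ∨-trueˡ (inV B u)) , (λ u v → ∨-trueˡ (inE B u v))

  ⊆-∪ʳ : (A B : Subgraph G) → B ⊆ₛ A ∪ₛ B
  ⊆-∪ʳ A B = (λ u → ∨-trueʳ (inV A u)) , (λ u v → ∨-trueʳ (inE A u v))

  Nonseparable : Subgraph G → Set
  Nonseparable H = Connected H × NoCutVertex H

  complete-walk : (H : Subgraph G) → Complete H
    → ∀ {ok x y} → x ∈ᵥ H → y ∈ᵥ H → ok x → ok y → Walk H ok x y
  complete-walk H H-complete {x = x} {y} x∈H y∈H ox oy with x ≟ y
  ... | yes refl = here x∈H ox
  ... | no x≢y = edge-walk ox oy (H-complete x y x∈H y∈H x≢y)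

  complete-nonseparable : (H : Subgraph G) → Complete H → ∀ {p} → p ∈ᵥ H → Nonseparable H
  complete-nonseparable H H-complete p∈H =
    ((_ , p∈H) , λ a b a∈H b∈H → complete-walk H H-complete a∈H b∈H tt tt) ,
    λ { w (_ , a , b , a≢w , b≢w , a⇝b , ¬a⇝b) →
          ¬a⇝b (complete-walk H H-complete (source∈ a⇝b) (target∈ a⇝b) a≢w b≢w) }

edge-irrefl : (G : Graph) {a c : Fin (n G)} → Edge G a c → a ≢ c
edge-irrefl G {a} e refl = true≢false e (irrefl G a)

vertexSubgraph : (G : Graph) → Fin (n G) → Subgraph G
vertexSubgraph G a = record
  { inV = λ x → does (x ≟ a) ; inE = λ _ _ → false ; inE-sym = λ _ _ → refl
  ; inE-adj = λ _ _ () ; inE-V = λ _ _ () }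

edgeSubgraph : (G : Graph) {a c : Fin (n G)} → Edge G a c → Subgraph G
edgeSubgraph G {a} {c} e = record
  { inV = λ x → does (x ≟ a ⊎-dec x ≟ c)
  ; inE = λ x y → does (ends? x y)
  ; inE-sym = λ x y → does-⇔ (mk⇔ swap swap) (ends? x y) (ends? y x)
  ; inE-adj = λ x y → adjacent ∘ does⇒ (ends? x y)
  ; inE-V = λ x y → dec-true (x ≟ a ⊎-dec x ≟ c) ∘ Sum.map proj₁ proj₁ ∘ does⇒ (ends? x y)
  }
  where
  Ends : Fin (n G) → Fin (n G) → Set
  Ends x y = (x ≡ a × y ≡ c) ⊎ (x ≡ c × y ≡ a)
  ends? : ∀ x y → Dec (Ends x y)
  ends? x y = (x ≟ a ×-dec y ≟ c) ⊎-dec (x ≟ c ×-dec y ≟ a)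
  swap : ∀ {x y} → Ends x y → Ends y x
  swap = Sum.swap ∘ Sum.map Product.swap Product.swap
  adjacent : ∀ {x y} → Ends x y → Edge G x y
  adjacent (inj₁ (refl , refl)) = e
  adjacent (inj₂ (refl , refl)) = trans (Graph.sym G c a) e

module _ (G : Graph) {a c : Fin (n G)} (e : Edge G a c) where

  edgeSubgraph-source : a ∈ᵥ edgeSubgraph G e
  edgeSubgraph-source = dec-true (a ≟ a ⊎-dec a ≟ c) (inj₁ refl)

  edgeSubgraph-target : c ∈ᵥ edgeSubgraph G e
  edgeSubgraph-target = dec-true (c ≟ a ⊎-dec c ≟ c) (inj₂ refl)

  edgeSubgraph-edge : inE (edgeSubgraph G e) a c ≡ true
  edgeSubgraph-edge = dec-true ((a ≟ a ×-dec c ≟ c) ⊎-dec (a ≟ c ×-dec c ≟ a)) (inj₁ (refl , refl))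

  edgeSubgraph-edge⁻ : inE (edgeSubgraph G e) c a ≡ true
  edgeSubgraph-edge⁻ = trans (inE-sym (edgeSubgraph G e) c a) edgeSubgraph-edge

  edgeSubgraph-ends : ∀ {x} → x ∈ᵥ edgeSubgraph G e → x ≡ a ⊎ x ≡ c
  edgeSubgraph-ends {x} = does⇒ (x ≟ a ⊎-dec x ≟ c)

  edgeSubgraph-complete : Complete (edgeSubgraph G e)
  edgeSubgraph-complete x y x∈ y∈ x≢y with edgeSubgraph-ends {x} x∈ | edgeSubgraph-ends {y} y∈
  ... | inj₁ refl | inj₁ refl = contradiction refl x≢y
  ... | inj₁ refl | inj₂ refl = edgeSubgraph-edge
  ... | inj₂ refl | inj₁ refl = edgeSubgraph-edge⁻
  ... | inj₂ refl | inj₂ refl = contradiction refl x≢y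

-- What the proof uses about a p–q path X: deleting any vertex w leaves every other vertex of X joined
-- to an end, and to both ends if w is not on X.
record PathLike {G : Graph} (X : Subgraph G) (p q : Fin (n G)) : Set where
  field
    start∈ : p ∈ᵥ X
    reach-start : ∀ x → x ∈ᵥ X → Reach X x p
    avoiding-reach-an-end : ∀ w x → x ∈ᵥ X → x ≢ w → ReachAvoiding X w x p ⊎ ReachAvoiding X w x q
    avoiding-reach-both-ends : ∀ w x → x ∈ᵥ X → x ≢ w → w ∉ᵥ X
                             → ReachAvoiding X w x p × ReachAvoiding X w x q

open PathLike

vertexSubgraph-pathLike : (G : Graph) (a : Fin (n G)) → PathLike (vertexSubgraph G a) a a
vertexSubgraph-pathLike G a = record
  { start∈ = a∈
  ; reach-start = λ { x x∈ → subst (λ y → Reach _ y a) (sym (does⇒ (x ≟ a) x∈)) (here a∈ tt) }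
  ; avoiding-reach-an-end = λ { w x x∈ x≢w → inj₁ (trivial-walk x x∈ x≢w) }
  ; avoiding-reach-both-ends = λ { w x x∈ x≢w _ → trivial-walk x x∈ x≢w , trivial-walk x x∈ x≢w }
  }
  where
  a∈ : a ∈ᵥ vertexSubgraph G a
  a∈ = dec-true (a ≟ a) refl
  trivial-walk : ∀ {w} x → x ∈ᵥ vertexSubgraph G a → x ≢ w → ReachAvoiding (vertexSubgraph G a) w x a
  trivial-walk x x∈ x≢w with does⇒ (x ≟ a) x∈
  ... | refl = here a∈ x≢w

module _ (G : Graph) {a c q : Fin (n G)} (e : Edge G a c)
         (Y : Subgraph G) (Y-path : PathLike Y c q) (a∉Y : a ∉ᵥ Y) where

  private
    E X : Subgraph G
    E = edgeSubgraph G e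
    X = E ∪ₛ Y
    Y⊆X : Y ⊆ₛ X
    Y⊆X = ⊆-∪ʳ E Y
    a∈X : a ∈ᵥ X
    a∈X = ∨-trueˡ (inV Y a) (edgeSubgraph-source G e)
    ca∈X : inE X c a ≡ true
    ca∈X = ∨-trueˡ (inE Y c a) (edgeSubgraph-edge⁻ G e)
    ac∈X : inE X a c ≡ true
    ac∈X = ∨-trueˡ (inE Y a c) (edgeSubgraph-edge G e)
    c∈Y : c ∈ᵥ Y
    c∈Y = start∈ Y-path

    reach-a : ∀ x → x ∈ᵥ X → Reach X x a
    reach-a x x∈X with ∨-true⁻ {inV E x} x∈X
    ... | inj₂ x∈Y = ⊆-walk Y⊆X (reach-start Y-path x x∈Y) ++ᵂ edge-walk tt tt ca∈X
    ... | inj₁ x∈E with edgeSubgraph-ends G e {x} x∈E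
    ...   | inj₁ refl = here a∈X tt
    ...   | inj₂ refl = edge-walk tt tt ca∈X

    reach-an-end : ∀ w x → x ∈ᵥ X → x ≢ w → ReachAvoiding X w x a ⊎ ReachAvoiding X w x q
    reach-an-end w x x∈X x≢w with ∨-true⁻ {inV E x} x∈X
    reach-an-end w x x∈X x≢w | inj₁ x∈E with edgeSubgraph-ends G e {x} x∈E
    ... | inj₁ refl = inj₁ (here a∈X x≢w)
    ... | inj₂ refl with a ≟ w
    ...   | no a≢w = inj₁ (edge-walk x≢w a≢w ca∈X)
    ...   | yes refl = inj₂ (⊆-walk Y⊆X (proj₂ (avoiding-reach-both-ends Y-path a c c∈Y x≢w a∉Y)))
    reach-an-end w x x∈X x≢w | inj₂ x∈Y with inV Y w in w∈?Y
    ... | false = inj₂ (⊆-walk Y⊆X (proj₂ (avoiding-reach-both-ends Y-path w x x∈Y x≢w w∈?Y)))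
    ... | true with avoiding-reach-an-end Y-path w x x∈Y x≢w
    ...   | inj₂ x⇝q = inj₂ (⊆-walk Y⊆X x⇝q)
    ...   | inj₁ x⇝c = inj₁ (⊆-walk Y⊆X x⇝c ++ᵂ edge-walk (target-ok x⇝c) a≢w ca∈X)
      where
      a≢w : a ≢ w
      a≢w refl = true≢false w∈?Y a∉Y

    reach-both-ends : ∀ w x → x ∈ᵥ X → x ≢ w → w ∉ᵥ X
                    → ReachAvoiding X w x a × ReachAvoiding X w x q
    reach-both-ends w x x∈X x≢w w∉X with ∨-false⁻ {inV E w} w∉X
    ... | w∉E , w∉Y = from-x (∨-true⁻ {inV E x} x∈X)
      where
      a≢w : a ≢ w
      a≢w refl = true≢false (edgeSubgraph-source G e) w∉E
      c≢w : c ≢ w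
      c≢w refl = true≢false (edgeSubgraph-target G e) w∉E
      from-c : ReachAvoiding X w c a × ReachAvoiding X w c q
      from-c = edge-walk c≢w a≢w ca∈X ,
               ⊆-walk Y⊆X (proj₂ (avoiding-reach-both-ends Y-path w c c∈Y c≢w w∉Y))
      from-x : x ∈ᵥ E ⊎ x ∈ᵥ Y → ReachAvoiding X w x a × ReachAvoiding X w x q
      from-x (inj₂ x∈Y) with avoiding-reach-both-ends Y-path w x x∈Y x≢w w∉Y
      ... | x⇝c , x⇝q = ⊆-walk Y⊆X x⇝c ++ᵂ proj₁ from-c , ⊆-walk Y⊆X x⇝q
      from-x (inj₁ x∈E) with edgeSubgraph-ends G e {x} x∈E
      ... | inj₂ refl = from-c
      ... | inj₁ refl = here a∈X x≢w , edge-walk x≢w c≢w ac∈X ++ᵂ proj₂ from-c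

  pathLike-extend : PathLike X a q
  pathLike-extend = record
    { start∈ = a∈X
    ; reach-start = reach-a
    ; avoiding-reach-an-end = reach-an-end
    ; avoiding-reach-both-ends = reach-both-ends
    }

data Path (G : Graph) : Fin (n G) → Fin (n G) → Set where
  nil : ∀ a → Path G a a
  cons : ∀ {c b} a → Edge G a c → Path G c b → Path G a b

module _ {G : Graph} where

  infix 4 _∈ₚ_

  _∈ₚ_ : ∀ {a b} → Fin (n G) → Path G a b → Set
  x ∈ₚ nil a = x ≡ a
  x ∈ₚ cons a _ P = x ≡ a ⊎ x ∈ₚ P

  Distinct : ∀ {a b} → Path G a b → Set
  Distinct (nil a) = ⊤
  Distinct (cons a _ P) = ¬ a ∈ₚ P × Distinct P

  source∈ₚ : ∀ {a b} (P : Path G a b) → a ∈ₚ P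
  source∈ₚ (nil a) = refl
  source∈ₚ (cons a _ P) = inj₁ refl

  _∈ₚ?_ : ∀ {a b} x (P : Path G a b) → Dec (x ∈ₚ P)
  x ∈ₚ? nil a = x ≟ a
  x ∈ₚ? cons a _ P = x ≟ a ⊎-dec x ∈ₚ? P

  suffix : ∀ {a c b} (P : Path G c b) → a ∈ₚ P → Distinct P → Σ (Path G a b) Distinct
  suffix (nil _) refl _ = nil _ , tt
  suffix (cons _ e P) (inj₁ refl) P-distinct = cons _ e P , P-distinct
  suffix (cons _ e P) (inj₂ a∈P) (_ , P-distinct) = suffix P a∈P P-distinct

  walk⇒path : ∀ {ok a b} → Walk (full G) ok a b → Σ (Path G a b) Distinct
  walk⇒path (here _ _) = nil _ , tt
  walk⇒path {a = a} (step _ e w) with walk⇒path w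
  ... | P , P-distinct with a ∈ₚ? P
  ...   | yes a∈P = suffix P a∈P P-distinct
  ...   | no a∉P = cons a e P , a∉P , P-distinct

  pathSubgraph : ∀ {a b} → Path G a b → Subgraph G
  pathSubgraph (nil a) = vertexSubgraph G a
  pathSubgraph (cons a e P) = edgeSubgraph G e ∪ₛ pathSubgraph P

  ∈ₚ⇒∈ᵥ : ∀ {a b x} (P : Path G a b) → x ∈ₚ P → x ∈ᵥ pathSubgraph P
  ∈ₚ⇒∈ᵥ (nil a) refl = dec-true (a ≟ a) refl
  ∈ₚ⇒∈ᵥ (cons a e P) (inj₁ refl) = ∨-trueˡ (inV (pathSubgraph P) a) (edgeSubgraph-source G e)
  ∈ₚ⇒∈ᵥ {x = x} (cons a e P) (inj₂ x∈P) = ∨-trueʳ (inV (edgeSubgraph G e) x) (∈ₚ⇒∈ᵥ P x∈P)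

  ∉ₚ⇒∉ᵥ : ∀ {a b x} (P : Path G a b) → ¬ x ∈ₚ P → x ∉ᵥ pathSubgraph P
  ∉ₚ⇒∉ᵥ {x = x} (nil a) x∉P = dec-false (x ≟ a) x∉P
  ∉ₚ⇒∉ᵥ {x = x} (cons {c} a e P) x∉P =
    cong₂ _∨_ (dec-false (x ≟ a ⊎-dec x ≟ c) [ x∉P ∘ inj₁ , x≢c ]′) (∉ₚ⇒∉ᵥ P (x∉P ∘ inj₂))
    where
    x≢c : x ≢ c
    x≢c refl = x∉P (inj₂ (source∈ₚ P))

  pathSubgraph-pathLike : ∀ {a b} (P : Path G a b) → Distinct P → PathLike (pathSubgraph P) a b
  pathSubgraph-pathLike (nil a) _ = vertexSubgraph-pathLike G a
  pathSubgraph-pathLike (cons a e P) (a∉P , P-distinct) =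
    pathLike-extend G e (pathSubgraph P) (pathSubgraph-pathLike P P-distinct) (∉ₚ⇒∉ᵥ P a∉P)

module _ {G : Graph} {H X : Subgraph G} (H-complete : Complete H) {p q : Fin (n G)}
         (p∈H : p ∈ᵥ H) (q∈H : q ∈ᵥ H) (p≢q : p ≢ q) (X-path : PathLike X p q) where

  private
    U : Subgraph G
    U = H ∪ₛ X
    H⊆U : H ⊆ₛ U
    H⊆U = ⊆-∪ˡ H X
    X⊆U : X ⊆ₛ U
    X⊆U = ⊆-∪ʳ H X

    toward : ∀ w {s s′} → s ∈ᵥ H → s′ ∈ᵥ H → s ≢ w
           → (∀ x → x ∈ᵥ X → x ≢ w → ReachAvoiding X w x s ⊎ ReachAvoiding X w x s′)
           → ∀ x → x ∈ᵥ U → x ≢ w → ReachAvoiding U w x s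
    toward w s∈H s′∈H s≢w X-reach x x∈U x≢w with ∨-true⁻ {inV H x} x∈U
    ... | inj₁ x∈H = ⊆-walk H⊆U (complete-walk H H-complete x∈H s∈H x≢w s≢w)
    ... | inj₂ x∈X with X-reach x x∈X x≢w
    ...   | inj₁ x⇝s = ⊆-walk X⊆U x⇝s
    ...   | inj₂ x⇝s′ =
      ⊆-walk X⊆U x⇝s′ ++ᵂ ⊆-walk H⊆U (complete-walk H H-complete s′∈H s∈H (target-ok x⇝s′) s≢w)

    avoiding-hub : ∀ w → ∃[ s ] (∀ x → x ∈ᵥ U → x ≢ w → ReachAvoiding U w x s)
    avoiding-hub w with p ≟ w
    ... | no p≢w = p , toward w p∈H q∈H p≢w (avoiding-reach-an-end X-path w)
    ... | yes refl = q , toward w q∈H p∈H (p≢q ∘ sym)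
                           (λ x x∈X x≢p → Sum.swap (avoiding-reach-an-end X-path p x x∈X x≢p))

    reach-p : ∀ x → x ∈ᵥ U → Reach U x p
    reach-p x x∈U with ∨-true⁻ {inV H x} x∈U
    ... | inj₁ x∈H = ⊆-walk H⊆U (complete-walk H H-complete x∈H p∈H tt tt)
    ... | inj₂ x∈X = ⊆-walk X⊆U (reach-start X-path x x∈X)

  complete-∪-pathLike-nonseparable : Nonseparable (H ∪ₛ X)
  complete-∪-pathLike-nonseparable =
    ((p , ∨-trueˡ (inV X p) p∈H) , λ a b a∈U b∈U → reach-p a a∈U ++ᵂ reverse (reach-p b b∈U)) ,
    λ { w (_ , a , b , a≢w , b≢w , a⇝b , ¬a⇝b) →
          let hub = proj₂ (avoiding-hub w)
          in ¬a⇝b (hub a (source∈ a⇝b) a≢w ++ᵂ reverse (hub b (target∈ a⇝b) b≢w)) }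

complete-pathLike : {G : Graph} (H : Subgraph G) → Complete H
  → ∀ {p q} → p ∈ᵥ H → q ∈ᵥ H → p ≢ q → PathLike H p q
complete-pathLike H H-complete {p} {q} p∈H q∈H p≢q = record
  { start∈ = p∈H
  ; reach-start = λ x x∈H → complete-walk H H-complete x∈H p∈H tt tt
  ; avoiding-reach-an-end = an-end
  ; avoiding-reach-both-ends = λ w x x∈H x≢w w∉H →
      complete-walk H H-complete x∈H p∈H x≢w (λ { refl → true≢false p∈H w∉H }) ,
      complete-walk H H-complete x∈H q∈H x≢w (λ { refl → true≢false q∈H w∉H })
  }
  where
  an-end : ∀ w x → x ∈ᵥ H → x ≢ w → ReachAvoiding H w x p ⊎ ReachAvoiding H w x q
  an-end w x x∈H x≢w with p ≟ w
  ... | no p≢w = inj₁ (complete-walk H H-complete x∈H p∈H x≢w p≢w)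
  ... | yes refl = inj₂ (complete-walk H H-complete x∈H q∈H x≢w (p≢q ∘ sym))

module _ {G : Graph} where

  block-absorbs : ∀ {B} (H : Subgraph G) → IsBlock G B → B ⊆ₛ H → Nonseparable H → H ⊆ₛ B
  block-absorbs _ (_ , _ , maximal) B⊆H (H-connected , H-uncut) = proj₁ (maximal _ B⊆H H-connected H-uncut)

  complete-blocks-sharing-two-vertices : ∀ {A B : Subgraph G} → IsBlock G A → IsBlock G B
    → Complete A → Complete B → ∀ {p q} → p ∈ᵥ A → q ∈ᵥ A → p ∈ᵥ B → q ∈ᵥ B → p ≢ q → A ≐ B
  complete-blocks-sharing-two-vertices {A} {B} A-block B-block A-complete B-complete p∈A q∈A p∈B q∈B p≢q =
    ⊆ₛ-trans {A = A} {A ∪ₛ B} {B} (⊆-∪ˡ A B) (block-absorbs (A ∪ₛ B) B-block (⊆-∪ʳ A B) A∪B-nonseparable) ,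
    ⊆ₛ-trans {A = B} {A ∪ₛ B} {A} (⊆-∪ʳ A B) (block-absorbs (A ∪ₛ B) A-block (⊆-∪ˡ A B) A∪B-nonseparable)
    where
    A∪B-nonseparable : Nonseparable (A ∪ₛ B)
    A∪B-nonseparable =
      complete-∪-pathLike-nonseparable A-complete p∈A q∈A p≢q (complete-pathLike B B-complete p∈B q∈B p≢q)

module _ (G : Graph) where

  vertex-weight : Subgraph G → Fin (n G) → ℕ
  vertex-weight H x = indicator (inV H x) + ∑ (indicator ∘ inE H x)

  weight : Subgraph G → ℕ
  weight H = ∑ (vertex-weight H)

  maxWeight : ℕ
  maxWeight = n G * (1 + n G * 1)

  vertex-weight-mono : ∀ {A B : Subgraph G} → A ⊆ₛ B → ∀ x → vertex-weight A x ≤ vertex-weight B x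
  vertex-weight-mono (A⊆B , EA⊆EB) x = +-mono-≤ (indicator-mono (A⊆B x)) (∑-mono-≤ (indicator-mono ∘ EA⊆EB x))

  weight-mono : ∀ {A B : Subgraph G} → A ⊆ₛ B → weight A ≤ weight B
  weight-mono {A} {B} A⊆B = ∑-mono-≤ (vertex-weight-mono {A} {B} A⊆B)

  weight-≤ : ∀ A → weight A ≤ maxWeight
  weight-≤ A = ∑-≤ _ λ x → +-mono-≤ (indicator-≤1 (inV A x)) (∑-≤ 1 (indicator-≤1 ∘ inE A x))

  weight-≡⇒⊇ : ∀ {A B : Subgraph G} → A ⊆ₛ B → weight A ≡ weight B → B ⊆ₛ A
  weight-≡⇒⊇ {A} {B} A⊆B@(V⊆ , E⊆) w≡ =
    (λ x → trans (indicator-injective (proj₁ (split x)))) ,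
    (λ x y → trans (indicator-injective (∑-≡-pointwise (indicator-mono ∘ E⊆ x) (proj₂ (split x)) y)))
    where
    split : ∀ x → indicator (inV A x) ≡ indicator (inV B x) × ∑ (indicator ∘ inE A x) ≡ ∑ (indicator ∘ inE B x)
    split x = +-≡-componentwise (indicator-mono (V⊆ x)) (∑-mono-≤ (indicator-mono ∘ E⊆ x))
                (∑-≡-pointwise (vertex-weight-mono {A} {B} A⊆B) w≡ x)

  infix 4 _⊃ₛ_

  _⊃ₛ_ : Subgraph G → Subgraph G → Set
  H′ ⊃ₛ H = H ⊆ₛ H′ × ¬ H′ ⊆ₛ H

  ⊃ₛ-wellFounded : WellFounded _⊃ₛ_
  ⊃ₛ-wellFounded =
    Subrelation.wellFounded {_<₂_ = _<_ on slack} (λ {H′} {H} → slack-decreases {H′} {H})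
      (On.wellFounded slack <-wellFounded)
    where
    slack : Subgraph G → ℕ
    slack H = maxWeight ∸ weight H
    slack-decreases : ∀ {H′ H : Subgraph G} → H′ ⊃ₛ H → slack H′ < slack H
    slack-decreases {H′} {H} (H⊆H′ , H′⊈H) =
      ∸-monoʳ-< (≤∧≢⇒< (weight-mono {H} {H′} H⊆H′) (H′⊈H ∘ weight-≡⇒⊇ {H} {H′} H⊆H′))
                (weight-≤ H′)

  MaximalNonseparable : Subgraph G → Set
  MaximalNonseparable B = Nonseparable B × (∀ H → B ⊆ₛ H → Nonseparable H → H ⊆ₛ B)

  -- Whether H has a proper nonseparable extension is not decidable, so the search for a maximal one
  -- runs under double negation; the conclusions drawn from blocks are boolean equations, hence stable.
  maximal-extension : ∀ H → Acc _⊃ₛ_ H → Nonseparable H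
    → DoubleNegation (∃[ B ] H ⊆ₛ B × MaximalNonseparable B)
  maximal-extension H (acc larger) H-nonseparable = ¬¬-excluded-middle >>= extend
    where
    extend : Dec (∃[ H′ ] H′ ⊃ₛ H × Nonseparable H′)
           → DoubleNegation (∃[ B ] H ⊆ₛ B × MaximalNonseparable B)
    extend (yes (H′ , H′⊃H@(H⊆H′ , _) , H′-nonseparable)) = do
      B , H′⊆B , B-maximal ← maximal-extension H′ (larger H′⊃H) H′-nonseparable
      pure (B , ⊆ₛ-trans {A = H} {H′} {B} H⊆H′ H′⊆B , B-maximal)
    extend (no no-extension) = pure (H , ⊆ₛ-refl {A = H} , H-nonseparable ,
      λ H′ H⊆H′ H′-nonseparable →
        ⊆ₛ-stable {A = H′} {H} (λ H′⊈H → no-extension (H′ , (H⊆H′ , H′⊈H) , H′-nonseparable)))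

  maximalNonseparable⇒block : ∀ {B : Subgraph G} → MaximalNonseparable B → IsBlock G B
  maximalNonseparable⇒block ((B-connected , B-uncut) , maximal) =
    B-connected , B-uncut , λ H B⊆H H-connected H-uncut → maximal H B⊆H (H-connected , H-uncut) , B⊆H

  edge-in-block : ∀ {p q} → Edge G p q → DoubleNegation (∃[ B ] IsBlock G B × p ∈ᵥ B × q ∈ᵥ B)
  edge-in-block {p} e = do
    B , (K₂⊆B , _) , B-maximal ← maximal-extension K₂ (⊃ₛ-wellFounded K₂) K₂-nonseparable
    pure ( B , maximalNonseparable⇒block B-maximal
         , K₂⊆B _ (edgeSubgraph-source G e) , K₂⊆B _ (edgeSubgraph-target G e))
    where
    K₂ : Subgraph G
    K₂ = edgeSubgraph G e
    K₂-nonseparable : Nonseparable K₂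
    K₂-nonseparable = complete-nonseparable K₂ (edgeSubgraph-complete G e) {p} (edgeSubgraph-source G e)

module _ {G H : Graph} (f : Fin (n G) → Fin (n H))
         (f-edge : ∀ {x y} → Edge G x y → Edge H (f x) (f y)) where

  mapPath : ∀ {a b} → Path G a b → Path H (f a) (f b)
  mapPath (nil a) = nil (f a)
  mapPath (cons a e P) = cons (f a) (f-edge e) (mapPath P)

  ∈ₚ-mapPath : ∀ {a b x} (P : Path G a b) → x ∈ₚ P → f x ∈ₚ mapPath P
  ∈ₚ-mapPath (nil a) refl = refl
  ∈ₚ-mapPath (cons a e P) (inj₁ refl) = inj₁ refl
  ∈ₚ-mapPath (cons a e P) (inj₂ x∈P) = inj₂ (∈ₚ-mapPath P x∈P)

  ∈ₚ-mapPath⁻ : ∀ {a b y} (P : Path G a b) → y ∈ₚ mapPath P → ∃[ x ] x ∈ₚ P × y ≡ f x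
  ∈ₚ-mapPath⁻ (nil a) y≡fa = a , refl , y≡fa
  ∈ₚ-mapPath⁻ (cons a e P) (inj₁ y≡fa) = a , inj₁ refl , y≡fa
  ∈ₚ-mapPath⁻ (cons a e P) (inj₂ y∈fP) with ∈ₚ-mapPath⁻ P y∈fP
  ... | x , x∈P , y≡fx = x , inj₂ x∈P , y≡fx

  mapPath-distinct : (∀ {x y} → f x ≡ f y → x ≡ y)
    → ∀ {a b} (P : Path G a b) → Distinct P → Distinct (mapPath P)
  mapPath-distinct f-injective (nil a) _ = tt
  mapPath-distinct f-injective (cons a e P) (a∉P , P-distinct) =
    fa∉fP , mapPath-distinct f-injective P P-distinct
    where
    fa∉fP : ¬ f a ∈ₚ mapPath P
    fa∉fP fa∈fP with ∈ₚ-mapPath⁻ P fa∈fP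
    ... | x , x∈P , fa≡fx = a∉P (subst (_∈ₚ P) (sym (f-injective fa≡fx)) x∈P)

module _ {W T : Graph} (cW : CanonicalTree W T) where
  open CanonicalTree cW

  vert-injective : ∀ {u v} → vert u ≡ vert v → u ≡ v
  vert-injective vu≡vv = inj₁-injective (emb-inj (inj₁ _) (inj₁ _) vu≡vv)

  bv-injective : ∀ {i j} → bv i ≡ bv j → i ≡ j
  bv-injective bi≡bj = inj₂-injective (emb-inj (inj₂ _) (inj₂ _) bi≡bj)

  edge-in-listed-block : ∀ {p q} → Edge W p q → DoubleNegation (∃[ i ] p ∈ᵥ blk i × q ∈ᵥ blk i)
  edge-in-listed-block e = do
    B , B-block , p∈B , q∈B ← edge-in-block W e
    let i , blk-i≐B = blk-surj B B-block
        B⊆blk-i = proj₁ (proj₂ blk-i≐B)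
    pure (i , B⊆blk-i _ p∈B , B⊆blk-i _ q∈B)

module Embedding {C D TC TD : Graph} (cC : CanonicalTree C TC) (cD : CanonicalTree D TD)
                 (C-cliqueTree : IsCliqueTree C) (D-cliqueTree : IsCliqueTree D)
                 (φ : Fin (n TC) → Fin (n TD)) (φ-injective : ∀ x y → φ x ≡ φ y → x ≡ y)
                 (φ-edge : ∀ x y → Edge TC x y → Edge TD (φ x) (φ y))
                 (ψ : Fin (n C) → Fin (n D))
                 (φ-vert : ∀ u → φ (CanonicalTree.vert cC u) ≡ CanonicalTree.vert cD (ψ u))
                 where
  module Cᵀ = CanonicalTree cC
  module Dᵀ = CanonicalTree cD

  ψ-injective : ∀ {u v} → ψ u ≡ ψ v → u ≡ v
  ψ-injective {u} {v} ψu≡ψv =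
    vert-injective cC (φ-injective _ _ (trans (φ-vert u) (trans (cong Dᵀ.vert ψu≡ψv) (sym (φ-vert v)))))

  C-block-complete : ∀ i → Complete (Cᵀ.blk i)
  C-block-complete i = proj₂ C-cliqueTree (Cᵀ.blk i) (Cᵀ.blk-isBlock i)

  D-block-complete : ∀ j → Complete (Dᵀ.blk j)
  D-block-complete j = proj₂ D-cliqueTree (Dᵀ.blk j) (Dᵀ.blk-isBlock j)

  vert-ψ-adjacent-φ-bv : ∀ {i z} → z ∈ᵥ Cᵀ.blk i → Edge TD (Dᵀ.vert (ψ z)) (φ (Cᵀ.bv i))
  vert-ψ-adjacent-φ-bv {i} {z} z∈blk-i =
    subst (λ t → Edge TD t (φ (Cᵀ.bv i))) (φ-vert z) (φ-edge _ _ (trans (Cᵀ.adj-vb z i) z∈blk-i))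

  φ-bv-is-bv : ∀ i → ∃[ j ] φ (Cᵀ.bv i) ≡ Dᵀ.bv j
  φ-bv-is-bv i with proj₁ (proj₁ (Cᵀ.blk-isBlock i)) | Dᵀ.emb-surj (φ (Cᵀ.bv i))
  ... | z , z∈blk-i | inj₁ w , vert-w≡ =
    ⊥-elim (true≢false (subst (Edge TD (Dᵀ.vert (ψ z))) (sym vert-w≡) (vert-ψ-adjacent-φ-bv z∈blk-i))
                       (Dᵀ.adj-vv (ψ z) w))
  ... | _ | inj₂ j , bv-j≡ = j , sym bv-j≡

  ψ-maps-block-into : ∀ {i j z} → φ (Cᵀ.bv i) ≡ Dᵀ.bv j → z ∈ᵥ Cᵀ.blk i → ψ z ∈ᵥ Dᵀ.blk j
  ψ-maps-block-into {i} {j} {z} φbv≡ z∈blk-i =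
    trans (sym (Dᵀ.adj-vb (ψ z) j)) (subst (Edge TD (Dᵀ.vert (ψ z))) φbv≡ (vert-ψ-adjacent-φ-bv z∈blk-i))

  preimage-block-unique : ∀ {i i′ j} → φ (Cᵀ.bv i) ≡ Dᵀ.bv j → φ (Cᵀ.bv i′) ≡ Dᵀ.bv j → i ≡ i′
  preimage-block-unique φbv≡ φbv′≡ = bv-injective cC (φ-injective _ _ (trans φbv≡ (sym φbv′≡)))

  ψ-edge : ∀ {u v} → Edge C u v → Edge D (ψ u) (ψ v)
  ψ-edge e = ≡-stable do
    i , u∈blk-i , v∈blk-i ← edge-in-listed-block cC e
    let j , φbv≡ = φ-bv-is-bv i
    pure (inE-adj (Dᵀ.blk j) _ _
      (D-block-complete j _ _ (ψ-maps-block-into φbv≡ u∈blk-i) (ψ-maps-block-into φbv≡ v∈blk-i)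
                              (edge-irrefl C e ∘ ψ-injective)))

  edge-in-preimage-block : ∀ {j x y} → Edge C x y → ψ x ∈ᵥ Dᵀ.blk j → ψ y ∈ᵥ Dᵀ.blk j
    → DoubleNegation (∃[ i ] φ (Cᵀ.bv i) ≡ Dᵀ.bv j × x ∈ᵥ Cᵀ.blk i × y ∈ᵥ Cᵀ.blk i)
  edge-in-preimage-block {j} e ψx∈blk-j ψy∈blk-j = do
    i , x∈blk-i , y∈blk-i ← edge-in-listed-block cC e
    let j′ , φbv≡ = φ-bv-is-bv i
        blk-j′≐blk-j = complete-blocks-sharing-two-vertices (Dᵀ.blk-isBlock j′) (Dᵀ.blk-isBlock j)
          (D-block-complete j′) (D-block-complete j)
          (ψ-maps-block-into φbv≡ x∈blk-i) (ψ-maps-block-into φbv≡ y∈blk-i) ψx∈blk-j ψy∈blk-j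
          (edge-irrefl C e ∘ ψ-injective)
    pure (i , subst (λ k → φ (Cᵀ.bv i) ≡ Dᵀ.bv k) (Dᵀ.blk-inj j′ j blk-j′≐blk-j) φbv≡ , x∈blk-i , y∈blk-i)

  path-stays-in-block : ∀ {i j a b} → φ (Cᵀ.bv i) ≡ Dᵀ.bv j → (P : Path C a b)
    → (∀ x → x ∈ₚ P → ψ x ∈ᵥ Dᵀ.blk j) → a ∈ᵥ Cᵀ.blk i → DoubleNegation (b ∈ᵥ Cᵀ.blk i)
  path-stays-in-block _ (nil _) _ a∈blk-i = pure a∈blk-i
  path-stays-in-block {i} φbv≡ (cons a e P) ψP⊆blk-j _ = do
    i′ , φbv′≡ , _ , c∈blk-i′ ← edge-in-preimage-block e (ψP⊆blk-j a (inj₁ refl))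
                                                        (ψP⊆blk-j _ (inj₂ (source∈ₚ P)))
    path-stays-in-block φbv≡ P (λ x → ψP⊆blk-j x ∘ inj₂)
      (subst (λ k → _ ∈ᵥ Cᵀ.blk k) (preimage-block-unique φbv′≡ φbv≡) c∈blk-i′)

  path-ends-in-block : ∀ {j a b} (P : Path C a b) → a ≢ b → (∀ x → x ∈ₚ P → ψ x ∈ᵥ Dᵀ.blk j)
    → DoubleNegation (∃[ i ] a ∈ᵥ Cᵀ.blk i × b ∈ᵥ Cᵀ.blk i)
  path-ends-in-block (nil a) a≢a _ = contradiction refl a≢a
  path-ends-in-block (cons a e P) _ ψP⊆blk-j = do
    i , φbv≡ , a∈blk-i , c∈blk-i ← edge-in-preimage-block e (ψP⊆blk-j a (inj₁ refl))
                                                           (ψP⊆blk-j _ (inj₂ (source∈ₚ P)))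
    b∈blk-i ← path-stays-in-block φbv≡ P (λ x → ψP⊆blk-j x ∘ inj₂) c∈blk-i
    pure (i , a∈blk-i , b∈blk-i)

  path-image-in-block : ∀ {j a b} (P : Path C a b) → Distinct P → a ≢ b
    → ψ a ∈ᵥ Dᵀ.blk j → ψ b ∈ᵥ Dᵀ.blk j → ∀ x → x ∈ₚ P → ψ x ∈ᵥ Dᵀ.blk j
  path-image-in-block {j} {a} {b} P P-distinct a≢b ψa∈blk-j ψb∈blk-j x x∈P =
    proj₁ (block-absorbs (Dᵀ.blk j ∪ₛ Q) (Dᵀ.blk-isBlock j) (⊆-∪ˡ (Dᵀ.blk j) Q) blk-j∪Q-nonseparable) (ψ x)
      (∨-trueʳ (inV (Dᵀ.blk j) (ψ x)) (∈ₚ⇒∈ᵥ ψP (∈ₚ-mapPath ψ ψ-edge P x∈P)))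
    where
    ψP : Path D (ψ a) (ψ b)
    ψP = mapPath ψ ψ-edge P
    Q : Subgraph D
    Q = pathSubgraph ψP
    blk-j∪Q-nonseparable : Nonseparable (Dᵀ.blk j ∪ₛ Q)
    blk-j∪Q-nonseparable =
      complete-∪-pathLike-nonseparable (D-block-complete j) ψa∈blk-j ψb∈blk-j (a≢b ∘ ψ-injective)
      (pathSubgraph-pathLike ψP (mapPath-distinct ψ ψ-edge ψ-injective P P-distinct))

  ψ-edge⁻ : ∀ {u v} → Edge D (ψ u) (ψ v) → Edge C u v
  ψ-edge⁻ {u} {v} e with walk⇒path (proj₂ (proj₁ C-cliqueTree) u v refl refl)
  ... | P , P-distinct = ≡-stable do
    j , ψu∈blk-j , ψv∈blk-j ← edge-in-listed-block cD e
    i , u∈blk-i , v∈blk-i ←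
      path-ends-in-block P u≢v (path-image-in-block P P-distinct u≢v ψu∈blk-j ψv∈blk-j)
    pure (inE-adj (Cᵀ.blk i) u v (C-block-complete i u v u∈blk-i v∈blk-i u≢v))
    where
    u≢v : u ≢ v
    u≢v = edge-irrefl D e ∘ cong ψ

lemma16 : (C D TC TD : Graph) (cC : CanonicalTree C TC) (cD : CanonicalTree D TD)
    → IsCliqueTree C → IsCliqueTree D
    → (φ : Fin (n TC) → Fin (n TD))
    → (∀ x y → φ x ≡ φ y → x ≡ y)
    → (∀ x y → Edge TC x y → Edge TD (φ x) (φ y))
    → (∀ u → ∃[ w ] φ (CanonicalTree.vert cC u) ≡ CanonicalTree.vert cD w)
    → Σ (Fin (n C) → Fin (n D)) λ ψ → ((∀ u → φ (CanonicalTree.vert cC u) ≡ CanonicalTree.vert cD (ψ u))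
              × (∀ u v → ψ u ≡ ψ v → u ≡ v)
              × (∀ u v → (Edge C u v ⇔ Edge D (ψ u) (ψ v))))
lemma16 C D TC TD cC cD C-cliqueTree D-cliqueTree φ φ-injective φ-edge vertex-image =
  ψ , φ-vert , (λ _ _ → ψ-injective) , λ _ _ → mk⇔ ψ-edge ψ-edge⁻
  where
  ψ : Fin (n C) → Fin (n D)
  ψ = proj₁ ∘ vertex-image
  φ-vert : ∀ u → φ (CanonicalTree.vert cC u) ≡ CanonicalTree.vert cD (ψ u)
  φ-vert = proj₂ ∘ vertex-image
  open Embedding cC cD C-cliqueTree D-cliqueTree φ φ-injective φ-edge ψ φ-vert
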